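{- Let $(X, \delta\colon X \rightarrow (\mathcal{P}_{\omega} X)^A)$ be an LTS. Then for all $x\in X$, $w\in A^*$, and $\mathcal{I} \in \{\mathcal{R}, \mathcal{F}\}$, $[\![ \{x\} ]\!](w) = \varphi^{\mathcal{I}}_{x}(w)$.
   Context: An LTS is a pair $(X,\delta\colon X\to(\mathcal{P}_\omega X)^A)$ ($\mathcal{P}_\omega$ = finite powerset); write $x\xrightarrow{a}y$ iff $y\in\delta(x)(a)$, extended to words $w\in A^*$ in the usual way ($x\xrightarrow{\varepsilon}y$ iff $y=x$). For $\varphi\colon A\to\mathcal{P}_\omega X$, $I(\varphi)=\{a\in A\mid \varphi(a)\neq\emptyset\}$ and $Fail(\varphi)=\{Z\subseteq A\mid Z\cap I(\varphi)=\emptyset\}$. The LTS is decorated with an output $\overline{o}_{\mathcal{I}}\colon X\to B=\mathcal{P}_\omega(\mathcal{P}_\omega A)$, where $\overline{o}_{\mathcal{R}}(x)=\{I(\delta(x))\}$ (ready) and $\overline{o}_{\mathcal{F}}(x)=Fail(\delta(x))$ (failure). It is determinised into a Moore automaton $(\mathcal{P}_\omega X,\langle o,t\rangle)$ with $o(Y)=\bigcup_{y\in Y}\overline{o}_{\mathcal{I}}(y)$ and $t(Y)(a)=\bigcup_{y\in Y}\delta(y)(a)$; $[\![-]\!]\colon \mathcal{P}_\omega X\to B^{A^*}$ is the unique map into the final Moore coalgebra, given by $[\![Y]\!](\varepsilon)=o(Y)$ and $[\![Y]\!](aw)=[\![t(Y)(a)]\!](w)$. Finally $\varphi^{\mathcal{R}}_{x}(w)=\{I(\delta(y))\mid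 x\xrightarrow{w}y\}$ and $\varphi^{\mathcal{F}}_x(w)=\{Z\subseteq A\mid \exists y.\ x\xrightarrow{w}y \land Z\in Fail(\delta(y))\}$ (these functions encode the sets of ready pairs, resp. failure pairs, of $x$). -}

module Defs where

open import Data.Nat using (ℕ)
open import Data.Fin using (Fin)
open import Data.Fin.Subset using (Subset; _∩_; inside; outside) renaming (⊥ to ∅ˢ)
open import Data.List using (List; []; _∷_; concatMap; [_])
open import Data.List.Membership.Propositional using (_∈_)
open import Data.Vec using (tabulate)
open import Data.Product using (Σ; _×_; ∃)
open import Relation.Binary.PropositionalEquality using (_≡_)

-- An LTS over the finite alphabet A = Fin n with states X:
-- δ : X → (P_ω X)^A, finite subsets of X represented by lists (read as sets via _∈_).
LTS : ℕ → Set → Set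
LTS n X = X → Fin n → List X

Word : ℕ → Set
Word n = List (Fin n)

-- Output set B = P_ω(P_ω A), represented by its membership predicate
-- (elements Z : Subset n = P_ω A); equality of B-values is extensional.
B : ℕ → Set₁
B n = Subset n → Set

nonEmpty : {X : Set} → List X → _
nonEmpty [] = outside
nonEmpty (_ ∷ _) = inside

I : {n : ℕ} {X : Set} → (Fin n → List X) → Subset n
I φ = tabulate (λ a → nonEmpty (φ a))

Fail : {n : ℕ} {X : Set} → (Fin n → List X) → B n
Fail φ Z = Z ∩ I φ ≡ ∅ˢ

data Sem : Set where
  𝓡 𝓕 : Sem

ō : {n : ℕ} {X : Set} → Sem → LTS n X → X → B n
ō 𝓡 δ x Z = Z ≡ I (δ x)
ō 𝓕 δ x Z = Fail (δ x) Z

-- determinisation into a Moore automaton on P_ω X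
o : {n : ℕ} {X : Set} → Sem → LTS n X → List X → B n
o 𝓘 δ Y Z = ∃ λ y → y ∈ Y × ō 𝓘 δ y Z

t : {n : ℕ} {X : Set} → LTS n X → List X → Fin n → List X
t δ Y a = concatMap (λ y → δ y a) Y

-- the unique map into the final Moore coalgebra B^{A*}
⟦_⟧ : {n : ℕ} {X : Set} → List X → Sem → LTS n X → Word n → B n
⟦ Y ⟧ 𝓘 δ []      = o 𝓘 δ Y
⟦ Y ⟧ 𝓘 δ (a ∷ w) = ⟦ t δ Y a ⟧ 𝓘 δ w

data _⊢_─[_]→_ {n : ℕ} {X : Set} (δ : LTS n X) : X → Word n → X → Set where
  ε-step : ∀ {x} → δ ⊢ x ─[ [] ]→ x
  a-step : ∀ {x y z a w} → y ∈ δ x a → δ ⊢ y ─[ w ]→ z → δ ⊢ x ─[ a ∷ w ]→ z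

φ : {n : ℕ} {X : Set} → Sem → LTS n X → X → Word n → B n
φ 𝓡 δ x w Z = ∃ λ y → δ ⊢ x ─[ w ]→ y × Z ≡ I (δ y)
φ 𝓕 δ x w Z = ∃ λ y → δ ⊢ x ─[ w ]→ y × Fail (δ y) Z

-- Call a state y an "emitter" of Z after w if some z with
-- y --w--> z has Z ∈ ō_𝓘(z).  We prove, for an ARBITRARY finite set Y of
-- states (not just a singleton), that Z ∈ ⟦ Y ⟧(w) iff some y ∈ Y is an
-- emitter of Z after w.  This goes by induction on w:
--   * for w = ε both sides say that Z ∈ ō_𝓘(y) for some y ∈ Y;
--   * for w = aw', ⟦ Y ⟧(aw') = ⟦ t(Y)(a) ⟧(w'), and since t(Y)(a) is the union
--     of the a-successor sets, "some element of t(Y)(a) emits after w'" is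
--     "some y ∈ Y has an a-successor emitting after w'", i.e. "some y ∈ Y
--     emits after aw'" (decomposition of the first transition of a path).
-- The theorem is the instance Y = {x}, together with the observation that
-- φ^𝓘_x(w) is, for both semantics, exactly "x is an emitter after w".
module Submission where

open import Defs
open import Data.Nat using (ℕ)
open import Data.Fin.Subset using (Subset)
open import Data.List using (List; []; _∷_; [_])
open import Data.List.Relation.Unary.Any using (Any) renaming (map to Any-map)
open import Data.List.Relation.Unary.Any.Properties using (concatMap⁺; concatMap⁻; singleton⁺; singleton⁻)
open import Data.List.Membership.Propositional using (_∈_; find; lose)
open import Data.Product using (∃; _×_; _,_)
open import Function.Bundles using (_⇔_; mk⇔; Equivalence)
open import Function.Properties.Equivalence using (sym) renaming (refl to ⇔-refl)
open import Function.Related.Propositional using (module EquationalReasoning; equivalence)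
open EquationalReasoning {k = equivalence}

Any-cong⇔ : {A : Set} {P Q : A → Set} → (∀ {y} → P y ⇔ Q y) →
  ∀ {ys} → Any P ys ⇔ Any Q ys
Any-cong⇔ P⇔Q = mk⇔ (Any-map (Equivalence.to P⇔Q)) (Any-map (Equivalence.from P⇔Q))

∃∈⇔Any : {A : Set} {P : A → Set} {ys : List A} → (∃ λ y → y ∈ ys × P y) ⇔ Any P ys
∃∈⇔Any = mk⇔ (λ (y , y∈ys , py) → lose y∈ys py) find

module _ {n : ℕ} {X : Set} (δ : LTS n X) (𝓘 : Sem) where

  Emits : Word n → Subset n → X → Set
  Emits w Z y = ∃ λ z → δ ⊢ y ─[ w ]→ z × ō 𝓘 δ z Z

  emits-ε : ∀ {Z y} → Emits [] Z y ⇔ ō 𝓘 δ y Z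
  emits-ε = mk⇔ (λ { (_ , ε-step , out) → out }) (λ out → _ , ε-step , out)

  emits-step : ∀ {a w Z y} → Emits (a ∷ w) Z y ⇔ Any (Emits w Z) (δ y a)
  emits-step {a} {w} {Z} {y} = mk⇔ first-step rest-path
    where
    first-step : Emits (a ∷ w) Z y → Any (Emits w Z) (δ y a)
    first-step (z , a-step y→y′ y′→z , out) = lose y→y′ (z , y′→z , out)

    rest-path : Any (Emits w Z) (δ y a) → Emits (a ∷ w) Z y
    rest-path emits with find emits
    ... | _ , y→y′ , (z , y′→z , out) = z , a-step y→y′ y′→z , out

  semantics⇔emits : ∀ Y w Z → ⟦ Y ⟧ 𝓘 δ w Z ⇔ Any (Emits w Z) Y
  semantics⇔emits Y [] Z = begin
    o 𝓘 δ Y Z                      ∼⟨ ∃∈⇔Any ⟩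
    Any (λ y → ō 𝓘 δ y Z) Y        ∼⟨ Any-cong⇔ (sym emits-ε) ⟩
    Any (Emits [] Z) Y             ∎
  semantics⇔emits Y (a ∷ w) Z = begin
    ⟦ t δ Y a ⟧ 𝓘 δ w Z                      ∼⟨ semantics⇔emits (t δ Y a) w Z ⟩
    Any (Emits w Z) (t δ Y a)                ∼⟨ mk⇔ (concatMap⁻ succ) (concatMap⁺ succ) ⟩
    Any (λ y → Any (Emits w Z) (δ y a)) Y    ∼⟨ Any-cong⇔ (sym emits-step) ⟩
    Any (Emits (a ∷ w) Z) Y                  ∎
    where
    succ : X → List X
    succ y = δ y a

φ⇔emits : {n : ℕ} {X : Set} (δ : LTS n X) (𝓘 : Sem) (x : X) (w : Word n) (Z : Subset n) →
  φ 𝓘 δ x w Z ⇔ Emits δ 𝓘 w Z x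
φ⇔emits δ 𝓡 x w Z = ⇔-refl
φ⇔emits δ 𝓕 x w Z = ⇔-refl

theorem4p1 : {n : ℕ} {X : Set} (δ : LTS n X) (x : X) (w : Word n) (𝓘 : Sem) →
    ∀ Z → ⟦ [ x ] ⟧ 𝓘 δ w Z ⇔ φ 𝓘 δ x w Z
theorem4p1 δ x w 𝓘 Z = begin
  ⟦ [ x ] ⟧ 𝓘 δ w Z           ∼⟨ semantics⇔emits δ 𝓘 [ x ] w Z ⟩
  Any (Emits δ 𝓘 w Z) [ x ]   ∼⟨ mk⇔ singleton⁻ singleton⁺ ⟩
  Emits δ 𝓘 w Z x             ∼⟨ sym (φ⇔emits δ 𝓘 x w Z) ⟩
  φ 𝓘 δ x w Z                 ∎
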